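{- Let $F_\infty$ be the free group on countably many generators and let $\mathrm{NSub}(F_\infty)\subseteq 2^{F_\infty}$ be the space of normal subgroups of $F_\infty$ with the product (Cantor) topology. The class of $N\in\mathrm{NSub}(F_\infty)$ such that $F_\infty/N$ is sofic is $G_\delta$ (i.e. $\Pi^0_2$).
   Context: A countable group $G$ is sofic if for every finite subset $F\subseteq G$ and every $\varepsilon>0$ there exist $d\in\mathbb{N}$ and a map $\sigma:F\to\mathrm{Sym}(d)$ (not necessarily a homomorphism) such that: $\sigma(1)=\mathrm{id}$ if $1\in F$; for all $u,v,w\in F$ with $uv=w$ in $G$, $d_H(\sigma(u)\sigma(v),\sigma(w))<\varepsilon$; and for all distinct $u,v\in F$, $d_H(\sigma(u),\sigma(v))>1-\varepsilon$. Here $d_H$ is the normalised Hamming distance on $\mathrm{Sym}(d)$, $d_H(\pi,\rho)=\frac1d|\{i:\pi(i)\ne\rho(i)\}|$. -}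

module Defs where

open import Data.Nat using (ℕ; zero; suc)
open import Data.Nat.Properties using () renaming (_≟_ to _≟ℕ_)
open import Data.Bool using (Bool; true; false; not; _∧_; if_then_else_)
open import Data.Bool.Properties using () renaming (_≟_ to _≟B_)
open import Data.Product using (Σ; ∃; ∃-syntax; _×_; _,_; proj₁; proj₂)
open import Data.Product.Properties using (≡-dec)
open import Data.List using (List; []; _∷_; length; filter)
open import Data.List.Membership.Propositional using (_∈_)
open import Data.Fin using (Fin)
open import Data.Fin.Properties using () renaming (_≟_ to _≟F_)
open import Data.Fin.Permutation using (Permutation′; _⟨$⟩ʳ_)
open import Data.List using (allFin)
open import Data.Integer using (+_)
open import Data.Rational using (ℚ; _/_; _<_; _-_; 0ℚ; 1ℚ)
open import Relation.Nullary using (Dec; yes; no; ¬_; ¬?)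
open import Relation.Nullary.Decidable using (⌊_⌋)
open import Relation.Binary.PropositionalEquality using (_≡_; _≢_; refl)
open import Function.Bundles using (_⇔_)

-- The free group F∞ on countably many generators x₀, x₁, …
-- A letter (n , true) is xₙ, (n , false) is xₙ⁻¹.

Letter : Set
Letter = ℕ × Bool

_≟L_ : (a b : Letter) → Dec (a ≡ b)
_≟L_ = ≡-dec _≟ℕ_ _≟B_

invL : Letter → Letter
invL (n , b) = (n , not b)

isRed : List Letter → Bool
isRed [] = true
isRed (x ∷ []) = true
isRed (x ∷ y ∷ w) = if ⌊ y ≟L invL x ⌋ then false else isRed (y ∷ w)

F∞ : Set
F∞ = Σ (List Letter) (λ w → isRed w ≡ true)

private
  tailRed : ∀ y w → isRed (y ∷ w) ≡ true → isRed w ≡ true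
  tailRed y [] p = refl
  tailRed y (z ∷ w) p with z ≟L invL y
  ... | no _ = p

consR : Letter → List Letter → List Letter
consR x [] = x ∷ []
consR x (y ∷ w) = if ⌊ y ≟L invL x ⌋ then w else x ∷ y ∷ w

private
  red2 : ∀ x y w → isRed (y ∷ w) ≡ true → (b : Bool) → ⌊ y ≟L invL x ⌋ ≡ b →
         isRed (if b then w else x ∷ y ∷ w) ≡ true
  red2 x y w p true _ = tailRed y w p
  red2 x y w p false e with ⌊ y ≟L invL x ⌋
  red2 x y w p false refl | .false = p

consR-red : ∀ x w → isRed w ≡ true → isRed (consR x w) ≡ true
consR-red x [] p = refl
consR-red x (y ∷ w) p = red2 x y w p ⌊ y ≟L invL x ⌋ refl

consΣ : Letter → F∞ → F∞
consΣ x (w , p) = consR x w , consR-red x w p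

mulW : List Letter → F∞ → F∞
mulW [] v = v
mulW (x ∷ u) v = consΣ x (mulW u v)

ε : F∞
ε = [] , refl

infixl 7 _·_
_·_ : F∞ → F∞ → F∞
(u , _) · v = mulW u v

private
  invW : List Letter → F∞
  invW [] = ε
  invW (x ∷ u) = invW u · ((invL x ∷ []) , refl)

infix 8 _⁻¹
_⁻¹ : F∞ → F∞
(u , _) ⁻¹ = invW u

Sub : Set
Sub = F∞ → Bool

record IsNormal (N : Sub) : Set where
  field
    has-ε   : N ε ≡ true
    closed· : ∀ u v → N u ≡ true → N v ≡ true → N (u · v) ≡ true
    closed⁻¹ : ∀ u → N u ≡ true → N (u ⁻¹) ≡ true
    conj    : ∀ g u → N u ≡ true → N (g · u · g ⁻¹) ≡ true

-- Normalised Hamming distance on Sym(d), d = suc d'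

hamCount : ∀ {d} → (Fin d → Fin d) → (Fin d → Fin d) → ℕ
hamCount {d} f g = length (filter (λ i → ¬? (f i ≟F g i)) (allFin d))

dH : ∀ d' → (Fin (suc d') → Fin (suc d')) → (Fin (suc d') → Fin (suc d')) → ℚ
dH d' f g = (+ hamCount f g) / suc d'

-- A finite subset of F∞/N is given by representatives
-- f : Fin n → F∞ of pairwise distinct cosets; classes of u and v agree iff
-- u⁻¹v ∈ N.  Permutation products act as composition (πρ)(i) = π(ρ(i)).
SoficQuotient : Sub → Set
SoficQuotient N =
  (n : ℕ) (f : Fin n → F∞) →
  (∀ i j → i ≢ j → N (f i ⁻¹ · f j) ≡ false) →
  (e : ℚ) → 0ℚ < e →
  ∃[ d' ] Σ (Fin n → Permutation′ (suc d')) λ σ →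
      (∀ i → N (f i) ≡ true → ∀ x → σ i ⟨$⟩ʳ x ≡ x)
    × (∀ i j l → N ((f i · f j) ⁻¹ · f l) ≡ true →
         dH d' (λ x → σ i ⟨$⟩ʳ (σ j ⟨$⟩ʳ x)) (λ x → σ l ⟨$⟩ʳ x) < e)
    × (∀ i j → i ≢ j →
         1ℚ - e < dH d' (λ x → σ i ⟨$⟩ʳ x) (λ x → σ j ⟨$⟩ʳ x))

-- Product (Cantor) topology on 2^{F∞}: O is open iff membership of x in O
-- is witnessed by finitely many coordinates of x.

IsOpen : (Sub → Set) → Set
IsOpen O = ∀ x → O x →
  ∃[ W ] (∀ y → (∀ w → w ∈ W → y w ≡ x w) → O y)

IsGδ-in-NSub : (Sub → Set) → Set₁
IsGδ-in-NSub S = Σ (ℕ → Sub → Set) λ U →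
  (∀ k → IsOpen (U k)) × (∀ N → IsNormal N → S N ⇔ (∀ k → U k N))

{-# OPTIONS --safe #-}
module Submission where

-- For a fixed finite family f of elements of F∞, the soficity requirement on
-- F∞/N only consults N at the finitely many words f i, f i⁻¹ f j and
-- (f i f j)⁻¹ f l (every ε is tested against the same words), so the set
-- U_f of N satisfying it is open.  F∞ is countable, hence so are its finite
-- families, and the sofic N are the countable intersection of the U_f.

open import Defs
open import Data.Nat using (ℕ; zero; suc; _+_)
open import Data.Nat.Properties using (+-suc; +-identityʳ)
open import Data.Bool using (Bool; true; false)
open import Data.Bool.Properties using () renaming (_≟_ to _≟B_)
open import Data.Product using (Σ; ∃-syntax; _×_; _,_; proj₁; proj₂; uncurry)
open import Data.List using (List; _++_; map; allFin; cartesianProduct; cartesianProductWith)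
open import Data.List.Membership.Propositional using (_∈_)
open import Data.List.Membership.Propositional.Properties
  using (∈-map⁺; ∈-++⁺ˡ; ∈-++⁺ʳ; ∈-allFin; ∈-cartesianProductWith⁺; ∈-cartesianProduct⁺)
open import Data.Vec using (Vec; []; _∷_; lookup; tabulate; toList; fromList)
open import Data.Vec.Properties using (lookup∘tabulate; toList∘fromList)
open import Data.Fin using (Fin)
open import Data.Fin.Permutation using (Permutation′; _⟨$⟩ʳ_)
open import Data.Rational using (ℚ; _<_; _-_; 0ℚ; 1ℚ)
open import Function.Bundles using (mk⇔)
open import Function.Definitions using (StrictlySurjective)
open import Relation.Nullary using (Dec; yes; no; Irrelevant; contradiction)
open import Relation.Binary.PropositionalEquality
  using (_≡_; _≢_; _≗_; refl; sym; trans; cong; cong₂; subst)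
open import Axiom.UniquenessOfIdentityProofs using (module Decidable⇒UIP)

Enumerable : Set → Set
Enumerable A = Σ (ℕ → A) (StrictlySurjective _≡_)

module _ {A B : Set} where

  enumerable-map : (f : A → B) → StrictlySurjective _≡_ f → Enumerable A → Enumerable B
  enumerable-map f f-surj (e , e-surj) = (λ k → f (e k)) , surj
    where
    surj : StrictlySurjective _≡_ (λ k → f (e k))
    surj b with f-surj b
    ... | a , refl with e-surj a
    ... | k , refl = k , refl

ℕ-enumerable : Enumerable ℕ
ℕ-enumerable = (λ k → k) , λ k → k , refl

Bool-enumerable : Enumerable Bool
Bool-enumerable = enumerable-map isZero surj ℕ-enumerable
  where
  isZero : ℕ → Bool
  isZero zero    = true
  isZero (suc _) = false

  surj : StrictlySurjective _≡_ isZero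
  surj true  = 0 , refl
  surj false = 1 , refl

-- Cantor's enumeration of ℕ × ℕ, walking each anti-diagonal a + b = s from
-- (0 , s) to (s , 0).

next : ℕ × ℕ → ℕ × ℕ
next (a , zero)  = (zero , suc a)
next (a , suc b) = (suc a , b)

unpair : ℕ → ℕ × ℕ
unpair zero    = (zero , zero)
unpair (suc k) = next (unpair k)

private
  Reached : ℕ × ℕ → Set
  Reached p = ∃[ k ] unpair k ≡ p

  reached-next : ∀ {p} → Reached p → Reached (next p)
  reached-next (k , refl) = suc k , refl

  reached-diagonal : ∀ a b → Reached (zero , a + b) → Reached (a , b)
  reached-diagonal zero    b r = r
  reached-diagonal (suc a) b r =
    reached-next (reached-diagonal a (suc b) (subst (λ s → Reached (zero , s)) (sym (+-suc a b)) r))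

  reached-axis : ∀ s → Reached (zero , s)
  reached-axis zero    = zero , refl
  reached-axis (suc s) =
    reached-next (reached-diagonal s zero (subst (λ t → Reached (zero , t)) (sym (+-identityʳ s)) (reached-axis s)))

unpair-surjective : StrictlySurjective _≡_ unpair
unpair-surjective (a , b) = reached-diagonal a b (reached-axis (a + b))

enumerable-Σ : ∀ {A : Set} {B : A → Set} →
               Enumerable A → (∀ a → Enumerable (B a)) → Enumerable (Σ A B)
enumerable-Σ {A} {B} (e , e-surj) eB = enumerable-map pick pick-surj (unpair , unpair-surjective)
  where
  pick : ℕ × ℕ → Σ A B
  pick (i , j) = e i , proj₁ (eB (e i)) j

  pick-surj : StrictlySurjective _≡_ pick
  pick-surj (a , b) with e-surj a
  ... | i , refl with proj₂ (eB (e i)) b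
  ... | j , refl = (i , j) , refl

enumerable-Vec : ∀ {A : Set} → Enumerable A → ∀ n → Enumerable (Vec A n)
enumerable-Vec eA zero    = (λ _ → []) , λ { [] → zero , refl }
enumerable-Vec eA (suc n) =
  enumerable-map (uncurry _∷_) (λ { (x ∷ xs) → (x , xs) , refl })
                 (enumerable-Σ eA (λ _ → enumerable-Vec eA n))

enumerable-List : ∀ {A : Set} → Enumerable A → Enumerable (List A)
enumerable-List eA =
  enumerable-map (λ v → toList (proj₂ v)) (λ xs → (_ , fromList xs) , toList∘fromList xs)
                 (enumerable-Σ ℕ-enumerable (enumerable-Vec eA))

-- The witness is needed to send the elements outside P somewhere.
enumerable-subtype : ∀ {A : Set} {P : A → Set} → (∀ a → Dec (P a)) → (∀ a → Irrelevant (P a)) →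
                     Σ A P → Enumerable A → Enumerable (Σ A P)
enumerable-subtype {A} {P} P? P-irr default = enumerable-map restrict restrict-surj
  where
  restrict : A → Σ A P
  restrict a with P? a
  ... | yes p = a , p
  ... | no  _ = default

  restrict-fixes : ∀ a (p : P a) → restrict a ≡ (a , p)
  restrict-fixes a p with P? a
  ... | yes q = cong (a ,_) (P-irr a q p)
  ... | no ¬p = contradiction p ¬p

  restrict-surj : StrictlySurjective _≡_ restrict
  restrict-surj (a , p) = a , restrict-fixes a p

F∞-enumerable : Enumerable F∞
F∞-enumerable =
  enumerable-subtype (λ w → isRed w ≟B true) (λ _ → Decidable⇒UIP.≡-irrelevant _≟B_) ε
    (enumerable-List (enumerable-Σ ℕ-enumerable (λ _ → Bool-enumerable)))

families-enumerable : Enumerable (Σ ℕ (Vec F∞))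
families-enumerable = enumerable-Σ ℕ-enumerable (enumerable-Vec F∞-enumerable)

-- SoficQuotient N unfolds to ∀ n f → SoficOn N f.
SoficOn : Sub → ∀ {n} → (Fin n → F∞) → Set
SoficOn N {n} f =
  (∀ i j → i ≢ j → N (f i ⁻¹ · f j) ≡ false) →
  (e : ℚ) → 0ℚ < e →
  ∃[ d ] Σ (Fin n → Permutation′ (suc d)) λ σ →
      (∀ i → N (f i) ≡ true → ∀ x → σ i ⟨$⟩ʳ x ≡ x)
    × (∀ i j l → N ((f i · f j) ⁻¹ · f l) ≡ true →
         dH d (λ x → σ i ⟨$⟩ʳ (σ j ⟨$⟩ʳ x)) (λ x → σ l ⟨$⟩ʳ x) < e)
    × (∀ i j → i ≢ j →
         1ℚ - e < dH d (λ x → σ i ⟨$⟩ʳ x) (λ x → σ j ⟨$⟩ʳ x))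

SoficOn-transfer : ∀ {N N′ : Sub} {n} {f g : Fin n → F∞} →
  (∀ i → N′ (g i) ≡ N (f i)) →
  (∀ i j → N′ (g i ⁻¹ · g j) ≡ N (f i ⁻¹ · f j)) →
  (∀ i j l → N′ ((g i · g j) ⁻¹ · g l) ≡ N ((f i · f j) ⁻¹ · f l)) →
  SoficOn N f → SoficOn N′ g
SoficOn-transfer elements quotients products sofic distinct e e>0 =
  let d , σ , fixes , multiplicative , separated =
        sofic (λ i j i≢j → trans (sym (quotients i j)) (distinct i j i≢j)) e e>0
  in d , σ , (λ i Ngi → fixes i (trans (sym (elements i)) Ngi))
           , (λ i j l Ng → multiplicative i j l (trans (sym (products i j l)) Ng))
           , separated

SoficOn-resp-≗ : ∀ {N : Sub} {n} {f g : Fin n → F∞} → f ≗ g → SoficOn N f → SoficOn N g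
SoficOn-resp-≗ {N} {f = f} {g} f≗g = SoficOn-transfer {N} {N} {f = f} {g}
  (λ i → cong N (sym (f≗g i)))
  (λ i j → cong N (sym (cong₂ (λ u v → u ⁻¹ · v) (f≗g i) (f≗g j))))
  (λ i j l → cong N (sym (cong₂ (λ u v → u ⁻¹ · v) (cong₂ _·_ (f≗g i) (f≗g j)) (f≗g l))))

module _ {n} (f : Fin n → F∞) where

  quotient : Fin n → Fin n → F∞
  quotient i j = f i ⁻¹ · f j

  product-quotient : Fin n → Fin n × Fin n → F∞
  product-quotient i (j , l) = (f i · f j) ⁻¹ · f l

  probes : List F∞
  probes = map f (allFin n)
        ++ cartesianProductWith quotient (allFin n) (allFin n)
        ++ cartesianProductWith product-quotient (allFin n) (cartesianProduct (allFin n) (allFin n))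

  element∈probes : ∀ i → f i ∈ probes
  element∈probes i = ∈-++⁺ˡ (∈-map⁺ f (∈-allFin i))

  quotient∈probes : ∀ i j → quotient i j ∈ probes
  quotient∈probes i j = ∈-++⁺ʳ (map f (allFin n)) (∈-++⁺ˡ
    (∈-cartesianProductWith⁺ quotient (∈-allFin i) (∈-allFin j)))

  product-quotient∈probes : ∀ i j l → product-quotient i (j , l) ∈ probes
  product-quotient∈probes i j l = ∈-++⁺ʳ (map f (allFin n)) (∈-++⁺ʳ _
    (∈-cartesianProductWith⁺ product-quotient (∈-allFin i) (∈-cartesianProduct⁺ (∈-allFin j) (∈-allFin l))))

  SoficOn-open : IsOpen (λ N → SoficOn N f)
  SoficOn-open N sofic = probes , λ N′ agree → SoficOn-transfer {N} {N′} {f = f} {f}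
    (λ i → agree _ (element∈probes i))
    (λ i j → agree _ (quotient∈probes i j))
    (λ i j l → agree _ (product-quotient∈probes i j l))
    sofic

family : (k : ℕ) → Fin (proj₁ (proj₁ families-enumerable k)) → F∞
family k = lookup (proj₂ (proj₁ families-enumerable k))

SoficOn-all-families : ∀ {N} → (∀ k → SoficOn N (family k)) → SoficQuotient N
SoficOn-all-families {N} sofic n f =
  let k , k↦f = proj₂ families-enumerable (n , tabulate f)
  in SoficOn-resp-≗ {N} (lookup∘tabulate f)
       (subst (λ (_ , v) → SoficOn N (lookup v)) k↦f (sofic k))

proposition12p2 : IsGδ-in-NSub SoficQuotient
proposition12p2 =
    (λ k N → SoficOn N (family k))
  , (λ k → SoficOn-open (family k))
  , λ N _ → mk⇔ (λ sofic k → sofic _ (family k)) (SoficOn-all-families {N})
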